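{- Let $K$ be a field of characteristic zero, let $a,b\in K$ with $a\neq0$, and let $c$ be an indeterminate (parameter). Let $p(t)=a+bt+ct^2$, $h(t)=tp(t)$, let $\bar h(t)\in K[c][[t]]$ be the compositional inverse of $h(t)$ (so $h(\bar h(t))=\bar h(h(t))=t$), and let $A(t)=t/\bar h(t)$, a formal power series in $t$ whose coefficients are polynomials in $c$. Then for every integer $n\ge0$, $$[t^{n+2}]\left.\frac{d A(t)}{dc}\right|_{c=0}=\frac{(-b)^n}{a^{2n+2}}\binom{2n+1}{n+1},$$ where the derivative with respect to $c$ is taken coefficientwise.
   Context: $[t^m]f(t)$ denotes the coefficient of $t^m$ in the formal power series $f(t)$. $A(t)$ is the generating function of the A-sequence of the Riordan array $\bigl(1/(1-t^3),\,tp(t)\bigr)$. -}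

module Defs where

open import Level using (_⊔_)
open import Data.Nat using (ℕ; zero; suc; _∸_; _≟_)
open import Data.Product using (Σ)
open import Relation.Nullary using (¬_; yes; no)
open import Algebra.Bundles using (CommutativeRing)

record Field c ℓ : Set (Level.suc (c ⊔ ℓ)) where
  field
    commutativeRing : CommutativeRing c ℓ
  open CommutativeRing commutativeRing public
  field
    1≉0      : ¬ (1# ≈ 0#)
    inv      : (x : Carrier) → ¬ (x ≈ 0#) → Carrier
    inverseʳ : (x : Carrier) (x≉0 : ¬ (x ≈ 0#)) → (x * inv x x≉0) ≈ 1#

module RingOps {c ℓ} (R : CommutativeRing c ℓ) where
  open CommutativeRing R

  pow : Carrier → ℕ → Carrier
  pow x zero    = 1#
  pow x (suc n) = x * pow x n

  ι : ℕ → Carrier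
  ι zero    = 0#
  ι (suc k) = 1# + ι k

  CharZero : Set ℓ
  CharZero = (k : ℕ) → ¬ (ι (suc k) ≈ 0#)

  sumTo : ℕ → (ℕ → Carrier) → Carrier
  sumTo zero    f = f 0
  sumTo (suc n) f = sumTo n f + f (suc n)

  -- Formal power series in two variables t and c over R, i.e. elements
  -- of R[[c]][[t]];  S n j  is the coefficient of  t^n c^j.
  Series2 : Set c
  Series2 = ℕ → ℕ → Carrier

  _≈ₛ_ : Series2 → Series2 → Set ℓ
  f ≈ₛ g = ∀ n j → f n j ≈ g n j

  _+ₛ_ : Series2 → Series2 → Series2
  (f +ₛ g) n j = f n j + g n j

  _*ₛ_ : Series2 → Series2 → Series2
  (f *ₛ g) n j = sumTo n (λ m → sumTo j (λ i → f m i * g (n ∸ m) (j ∸ i)))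

  constₛ : Carrier → Series2
  constₛ x zero zero = x
  constₛ x _    _    = 0#

  oneₛ : Series2
  oneₛ = constₛ 1#

  tₛ : Series2
  tₛ (suc zero) zero = 1#
  tₛ _          _    = 0#

  cₛ : Series2
  cₛ zero (suc zero) = 1#
  cₛ _    _          = 0#

  powₛ : Series2 → ℕ → Series2
  powₛ g zero    = oneₛ
  powₛ g (suc k) = g *ₛ powₛ g k

  -- Meaningful when g has zero constant
  -- term in t (then only k ≤ n contribute to the coefficient of t^n).
  composeₛ : Series2 → Series2 → Series2
  composeₛ f g n j =
    sumTo n (λ k → sumTo j (λ i → f k i * powₛ g k n (j ∸ i)))

  NoConstTerm : Series2 → Set ℓ
  NoConstTerm f = ∀ j → f 0 j ≈ 0#

{-# OPTIONS --safe #-}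
-- Let H, G be the c⁰ and c¹ parts of hbar and Q the c¹ part of A, all series in t.
-- The c⁰ and c¹ parts of h(hbar) = t and A·hbar = t read aH + bH² = t,
-- (a + 2bH)G + H³ = 0, A₀H = t and A₀G + QH = 0; eliminating A₀ and G gives
-- Q(a + 2bH) = tH.  Applying the Euler operator θ = t d/dt to this and to
-- aH + bH² = t, and using (a + 2bH)² = a² + 4bt, eliminates H as well:
-- (a² + 4bt)θQ + 2btQ = t² + (a² + 4bt)Q.  Its coefficients form the recurrence
-- a²(n+1)q(n+2) + b(4n+2)q(n+1) = [n = 0] with q(1) = 0, which (a ≠ 0, characteristic
-- zero) has exactly one solution; the closed form solves it because
-- (n+2)·C(2n+3, n+2) = (4n+6)·C(2n+1, n+1).

module Submission where

open import Defs
open import Data.Nat using (ℕ; zero; suc; _∸_; _≤_; _<_; _≤′_; ≤′-refl; ≤′-step; z≤n; s≤s)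
import Data.Nat as N
import Data.Nat.Properties as NP
open import Data.Nat.Combinatorics using (_C_)
open import Data.Product using (_,_)
open import Data.Sum using (inj₁; inj₂)
open import Relation.Nullary using (¬_)
import Relation.Binary.PropositionalEquality as P
import Relation.Binary.Reasoning.Setoid as SetoidReasoning
open import Algebra.Bundles using (CommutativeRing; CommutativeSemiring)
import Algebra.Construct.Pointwise as Pointwise
import Algebra.Properties.CommutativeSemigroup as CommutativeSemigroupProperties
import Algebra.Properties.Semiring.Mult as SemiringMult
import Algebra.Properties.Ring as RingProperties

module FiniteSums {c ℓ} (R : CommutativeRing c ℓ) where
  open CommutativeRing R
  open RingOps R using (sumTo)
  open CommutativeSemigroupProperties +-commutativeSemigroup using (interchange)
  open SetoidReasoning setoid

  sumTo-cong≤ : ∀ n {f g : ℕ → Carrier} → (∀ m → m ≤ n → f m ≈ g m) → sumTo n f ≈ sumTo n g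
  sumTo-cong≤ zero    f≈g = f≈g 0 z≤n
  sumTo-cong≤ (suc n) f≈g = +-cong (sumTo-cong≤ n (λ m m≤n → f≈g m (NP.m≤n⇒m≤1+n m≤n))) (f≈g (suc n) NP.≤-refl)

  sumTo-cong : ∀ n {f g : ℕ → Carrier} → (∀ m → f m ≈ g m) → sumTo n f ≈ sumTo n g
  sumTo-cong n f≈g = sumTo-cong≤ n (λ m _ → f≈g m)

  sumTo-zero : ∀ n {f : ℕ → Carrier} → (∀ m → m ≤ n → f m ≈ 0#) → sumTo n f ≈ 0#
  sumTo-zero zero    f≈0 = f≈0 0 z≤n
  sumTo-zero (suc n) f≈0 =
    trans (+-cong (sumTo-zero n (λ m m≤n → f≈0 m (NP.m≤n⇒m≤1+n m≤n))) (f≈0 (suc n) NP.≤-refl)) (+-identityʳ 0#)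

  sumTo-+ : ∀ n (f g : ℕ → Carrier) → sumTo n (λ m → f m + g m) ≈ sumTo n f + sumTo n g
  sumTo-+ zero    f g = refl
  sumTo-+ (suc n) f g = trans (+-congʳ (sumTo-+ n f g)) (interchange _ _ _ _)

  *-distribˡ-sumTo : ∀ n x (f : ℕ → Carrier) → x * sumTo n f ≈ sumTo n (λ m → x * f m)
  *-distribˡ-sumTo zero    x f = refl
  *-distribˡ-sumTo (suc n) x f = trans (distribˡ _ _ _) (+-congʳ (*-distribˡ-sumTo n x f))

  *-distribʳ-sumTo : ∀ n x (f : ℕ → Carrier) → sumTo n f * x ≈ sumTo n (λ m → f m * x)
  *-distribʳ-sumTo zero    x f = refl
  *-distribʳ-sumTo (suc n) x f = trans (distribʳ _ _ _) (+-congʳ (*-distribʳ-sumTo n x f))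

  sumTo-unfoldˡ : ∀ n (f : ℕ → Carrier) → sumTo (suc n) f ≈ f 0 + sumTo n (λ m → f (suc m))
  sumTo-unfoldˡ zero    f = refl
  sumTo-unfoldˡ (suc n) f = trans (+-congʳ (sumTo-unfoldˡ n f)) (+-assoc _ _ _)

  sumTo-reverse : ∀ n (f : ℕ → Carrier) → sumTo n f ≈ sumTo n (λ m → f (n ∸ m))
  sumTo-reverse zero    f = refl
  sumTo-reverse (suc n) f = begin
    sumTo n f + f (suc n)                    ≈⟨ +-comm _ _ ⟩
    f (suc n) + sumTo n f                    ≈⟨ +-congˡ (sumTo-reverse n f) ⟩
    f (suc n) + sumTo n (λ m → f (n ∸ m))    ≈⟨ sym (sumTo-unfoldˡ n (λ m → f (suc n ∸ m))) ⟩
    sumTo (suc n) (λ m → f (suc n ∸ m))      ∎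

  sumTo-extend : ∀ {m n} {f : ℕ → Carrier} → m ≤′ n → (∀ k → m < k → f k ≈ 0#) → sumTo n f ≈ sumTo m f
  sumTo-extend ≤′-refl          f≈0 = refl
  sumTo-extend (≤′-step m≤′n) f≈0 =
    trans (+-cong (sumTo-extend m≤′n f≈0) (f≈0 _ (s≤s (NP.≤′⇒≤ m≤′n)))) (+-identityʳ _)

  sumTo-truncate : ∀ m n {f : ℕ → Carrier} → (∀ k → m < k → f k ≈ 0#) → (∀ k → n < k → f k ≈ 0#) →
                   sumTo n f ≈ sumTo m f
  sumTo-truncate m n f≈0>m f≈0>n with NP.≤-total m n
  ... | inj₁ m≤n = sumTo-extend (NP.≤⇒≤′ m≤n) f≈0>m
  ... | inj₂ n≤m = sym (sumTo-extend (NP.≤⇒≤′ n≤m) f≈0>n)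

  sumTo-triangle : ∀ n (F : ℕ → ℕ → Carrier) →
    sumTo n (λ m → sumTo m (λ k → F k m)) ≈ sumTo n (λ k → sumTo (n ∸ k) (λ l → F k (k N.+ l)))
  sumTo-triangle zero    F = refl
  sumTo-triangle (suc n) F = begin
    sumTo n (λ m → sumTo m (λ k → F k m)) + (sumTo n (λ k → F k (suc n)) + F (suc n) (suc n))
      ≈⟨ trans (sym (+-assoc _ _ _)) (+-congʳ (+-congʳ (sumTo-triangle n F))) ⟩
    (sumTo n (λ k → sumTo (n ∸ k) (λ l → F k (k N.+ l))) + sumTo n (λ k → F k (suc n))) + F (suc n) (suc n)
      ≈⟨ +-cong (trans (sym (sumTo-+ n _ _)) (sumTo-cong≤ n rowGrows)) diagonal ⟩
    sumTo n (λ k → sumTo (suc n ∸ k) (λ l → F k (k N.+ l))) + sumTo (n ∸ n) (λ l → F (suc n) (suc n N.+ l)) ∎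
    where
    rowGrows : ∀ k → k ≤ n → sumTo (n ∸ k) (λ l → F k (k N.+ l)) + F k (suc n)
                           ≈ sumTo (suc n ∸ k) (λ l → F k (k N.+ l))
    rowGrows k k≤n rewrite NP.+-∸-assoc 1 k≤n | P.sym (NP.m+[n∸m]≡n k≤n) | NP.m+n∸m≡n k (n ∸ k)
      | NP.+-suc k (n ∸ k) = refl
    diagonal : F (suc n) (suc n) ≈ sumTo (n ∸ n) (λ l → F (suc n) (suc n N.+ l))
    diagonal rewrite NP.n∸n≡0 n | NP.+-identityʳ n = refl

module NatEmbedding {c ℓ} (R : CommutativeRing c ℓ) where
  open CommutativeRing R
  open RingOps R using (ι)
  open SemiringMult semiring using (_×_; ×-homo-+; ×1-homo-*)

  ι≈×1# : ∀ n → ι n ≈ n × 1#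
  ι≈×1# zero    = refl
  ι≈×1# (suc n) = +-congˡ (ι≈×1# n)

  ι-homo-+ : ∀ m n → ι (m N.+ n) ≈ ι m + ι n
  ι-homo-+ m n = trans (ι≈×1# (m N.+ n)) (trans (×-homo-+ 1# m n) (sym (+-cong (ι≈×1# m) (ι≈×1# n))))

  ι-homo-* : ∀ m n → ι (m N.* n) ≈ ι m * ι n
  ι-homo-* m n = trans (ι≈×1# (m N.* n)) (trans (×1-homo-* m n) (sym (*-cong (ι≈×1# m) (ι≈×1# n))))

module PowerSeries {c ℓ} (R : CommutativeRing c ℓ) where
  open CommutativeRing R
  open RingOps R using (sumTo; ι)
  open FiniteSums R
  open NatEmbedding R using (ι-homo-+)
  open CommutativeSemigroupProperties *-commutativeSemigroup using (x∙yz≈y∙xz)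
  open SetoidReasoning setoid

  Series : Set c
  Series = ℕ → Carrier

  infix  4 _≋_
  infixl 6 _+ˢ_
  infixl 7 _*ˢ_

  _≋_ : Series → Series → Set ℓ
  f ≋ g = ∀ n → f n ≈ g n

  _+ˢ_ : Series → Series → Series
  (f +ˢ g) n = f n + g n

  _*ˢ_ : Series → Series → Series
  (f *ˢ g) n = sumTo n (λ m → f m * g (n ∸ m))

  constˢ : Carrier → Series
  constˢ x zero    = x
  constˢ x (suc n) = 0#

  0ˢ 1ˢ : Series
  0ˢ n = 0#
  1ˢ = constˢ 1#

  tˢ : Series
  tˢ zero    = 0#
  tˢ (suc n) = 1ˢ n

  constˢ-*ˢ : ∀ x f n → (constˢ x *ˢ f) n ≈ x * f n
  constˢ-*ˢ x f zero    = refl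
  constˢ-*ˢ x f (suc n) = begin
    (constˢ x *ˢ f) (suc n)                       ≈⟨ sumTo-unfoldˡ n _ ⟩
    x * f (suc n) + sumTo n (λ m → 0# * f (n ∸ m)) ≈⟨ +-congˡ (sumTo-zero n (λ m _ → zeroˡ _)) ⟩
    x * f (suc n) + 0#                            ≈⟨ +-identityʳ _ ⟩
    x * f (suc n)                                 ∎

  constˢ-+ˢ : ∀ x y → constˢ x +ˢ constˢ y ≋ constˢ (x + y)
  constˢ-+ˢ x y zero    = refl
  constˢ-+ˢ x y (suc n) = +-identityˡ 0#

  tˢ-*ˢ-zero : ∀ f → (tˢ *ˢ f) 0 ≈ 0#
  tˢ-*ˢ-zero f = zeroˡ _

  tˢ-*ˢ-suc : ∀ f n → (tˢ *ˢ f) (suc n) ≈ f n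
  tˢ-*ˢ-suc f n = trans (sumTo-unfoldˡ n _) (trans (+-cong (zeroˡ _) (constˢ-*ˢ 1# f n)) (trans (+-identityˡ _) (*-identityˡ _)))

  *ˢ-cong : ∀ {f f′ g g′} → f ≋ f′ → g ≋ g′ → f *ˢ g ≋ f′ *ˢ g′
  *ˢ-cong f≋f′ g≋g′ n = sumTo-cong n (λ m → *-cong (f≋f′ m) (g≋g′ (n ∸ m)))

  *ˢ-comm : ∀ f g → f *ˢ g ≋ g *ˢ f
  *ˢ-comm f g n = trans (sumTo-reverse n _) (sumTo-cong≤ n (λ m m≤n →
    trans (*-comm _ _) (*-congʳ (reflexive (P.cong g (NP.m∸[m∸n]≡n m≤n))))))

  *ˢ-assoc : ∀ f g h → (f *ˢ g) *ˢ h ≋ f *ˢ (g *ˢ h)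
  *ˢ-assoc f g h n = begin
    sumTo n (λ m → sumTo m (λ k → f k * g (m ∸ k)) * h (n ∸ m))
      ≈⟨ sumTo-cong n (λ m → *-distribʳ-sumTo m _ _) ⟩
    sumTo n (λ m → sumTo m (λ k → f k * g (m ∸ k) * h (n ∸ m)))
      ≈⟨ sumTo-triangle n (λ k m → f k * g (m ∸ k) * h (n ∸ m)) ⟩
    sumTo n (λ k → sumTo (n ∸ k) (λ l → f k * g ((k N.+ l) ∸ k) * h (n ∸ (k N.+ l))))
      ≈⟨ sumTo-cong n (λ k → sumTo-cong (n ∸ k) (λ l → trans (*-assoc _ _ _)
           (*-congˡ (*-cong (reflexive (P.cong g (NP.m+n∸m≡n k l))) (reflexive (P.cong h (P.sym (NP.∸-+-assoc n k l)))))))) ⟩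
    sumTo n (λ k → sumTo (n ∸ k) (λ l → f k * (g l * h ((n ∸ k) ∸ l))))
      ≈⟨ sumTo-cong n (λ k → sym (*-distribˡ-sumTo (n ∸ k) _ _)) ⟩
    (f *ˢ (g *ˢ h)) n ∎

  *ˢ-identityˡ : ∀ f → 1ˢ *ˢ f ≋ f
  *ˢ-identityˡ f n = trans (constˢ-*ˢ 1# f n) (*-identityˡ _)

  *ˢ-distribʳ : ∀ f g h → (g +ˢ h) *ˢ f ≋ g *ˢ f +ˢ h *ˢ f
  *ˢ-distribʳ f g h n = trans (sumTo-cong n (λ m → distribʳ _ _ _)) (sumTo-+ n _ _)

  powerSeriesRing : CommutativeRing c ℓ
  powerSeriesRing = record
    { isCommutativeRing = record
      { isRing = record
        { +-isAbelianGroup = Pointwise.isAbelianGroup ℕ +-isAbelianGroup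
        ; *-cong = *ˢ-cong
        ; *-assoc = *ˢ-assoc
        ; *-identity = *ˢ-identityˡ , λ f n → trans (*ˢ-comm f 1ˢ n) (*ˢ-identityˡ f n)
        ; distrib = (λ f g h n → trans (*ˢ-comm f (g +ˢ h) n) (trans (*ˢ-distribʳ f g h n)
                      (+-cong (*ˢ-comm g f n) (*ˢ-comm h f n))))
                  , *ˢ-distribʳ
        }
      ; *-comm = *ˢ-comm
      }
    }

  module 𝕊 = CommutativeRing powerSeriesRing
  module ≋-Reasoning = SetoidReasoning 𝕊.setoid

  tˢ-*ˢ-cancel : ∀ {f g} → tˢ *ˢ f ≋ tˢ *ˢ g → f ≋ g
  tˢ-*ˢ-cancel {f} {g} tf≋tg n = trans (sym (tˢ-*ˢ-suc f n)) (trans (tf≋tg (suc n)) (tˢ-*ˢ-suc g n))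

  θ : Series → Series
  θ f n = ι n * f n

  θ-cong : ∀ {f g} → f ≋ g → θ f ≋ θ g
  θ-cong f≋g n = *-congˡ (f≋g n)

  θ-+ˢ : ∀ f g → θ (f +ˢ g) ≋ θ f +ˢ θ g
  θ-+ˢ f g n = distribˡ _ _ _

  θ-constˢ : ∀ x → θ (constˢ x) ≋ 0ˢ
  θ-constˢ x zero    = zeroˡ _
  θ-constˢ x (suc n) = zeroʳ _

  θ-tˢ : θ tˢ ≋ tˢ
  θ-tˢ 0             = zeroˡ _
  θ-tˢ 1             = trans (*-identityʳ _) (+-identityʳ _)
  θ-tˢ (suc (suc n)) = zeroʳ _

  θ-*ˢ : ∀ f g → θ (f *ˢ g) ≋ θ f *ˢ g +ˢ f *ˢ θ g
  θ-*ˢ f g n = trans (*-distribˡ-sumTo n _ _) (trans (sumTo-cong≤ n leibniz) (sumTo-+ n _ _))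
    where
    leibniz : ∀ m → m ≤ n → ι n * (f m * g (n ∸ m)) ≈ ι m * f m * g (n ∸ m) + f m * (ι (n ∸ m) * g (n ∸ m))
    leibniz m m≤n = begin
      ι n * (f m * g (n ∸ m))
        ≈⟨ *-congʳ (trans (reflexive (P.cong ι (P.sym (NP.m+[n∸m]≡n m≤n)))) (ι-homo-+ m (n ∸ m))) ⟩
      (ι m + ι (n ∸ m)) * (f m * g (n ∸ m))
        ≈⟨ distribʳ _ _ _ ⟩
      ι m * (f m * g (n ∸ m)) + ι (n ∸ m) * (f m * g (n ∸ m))
        ≈⟨ +-cong (sym (*-assoc _ _ _)) (x∙yz≈y∙xz _ _ _) ⟩
      ι m * f m * g (n ∸ m) + f m * (ι (n ∸ m) * g (n ∸ m)) ∎

  θ-*ˢ-constant : ∀ f g → θ f ≋ 0ˢ → θ (f *ˢ g) ≋ f *ˢ θ g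
  θ-*ˢ-constant f g θf≋0 =
    𝕊.trans (θ-*ˢ f g) (𝕊.trans (𝕊.+-congʳ (𝕊.trans (*ˢ-cong {g = g} θf≋0 𝕊.refl) (𝕊.zeroˡ g))) (𝕊.+-identityˡ _))

-- Stated without subtraction, so that they hold in every commutative semiring
-- and the natural-coefficient solver applies.
module InverseSeriesAlgebra {c ℓ} (S : CommutativeSemiring c ℓ) where
  open CommutativeSemiring S
  open import Algebra.Solver.Ring.NaturalCoefficients.Default S
  open SetoidReasoning setoid

  quotient-relation : ∀ a b A Q G H t → A * H ≈ t → A * G + Q * H ≈ 0# →
    a * G + b * (H * G + G * H) + H * H * H ≈ 0# →
    t * (Q * (a + (b + b) * H)) ≈ t * (t * H)
  quotient-relation a b A Q G H t AH≈t AG+QH≈0 aG+b2HG+H³≈0 = begin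
    t * (Q * D)                                      ≈⟨ *-congʳ (sym AH≈t) ⟩
    A * H * (Q * D)                                  ≈⟨ sym (+-identityʳ _) ⟩
    A * H * (Q * D) + 0#                             ≈⟨ +-congˡ (trans (sym (zeroʳ (A * A))) (*-congˡ (sym aG+b2HG+H³≈0))) ⟩
    A * H * (Q * D) + A * A * (a * G + b * (H * G + G * H) + H * H * H)
      ≈⟨ solve 6 (λ a b A Q G H →
           A :* H :* (Q :* (a :+ (b :+ b) :* H)) :+ A :* A :* (a :* G :+ b :* (H :* G :+ G :* H) :+ H :* H :* H)
           := A :* (a :+ (b :+ b) :* H) :* (A :* G :+ Q :* H) :+ A :* H :* (A :* H) :* H) refl a b A Q G H ⟩
    A * D * (A * G + Q * H) + A * H * (A * H) * H
      ≈⟨ +-cong (trans (*-congˡ AG+QH≈0) (zeroʳ _)) (*-congʳ (*-cong AH≈t AH≈t)) ⟩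
    0# + t * t * H                                   ≈⟨ trans (+-identityˡ _) (*-assoc _ _ _) ⟩
    t * (t * H)                                      ∎
    where
    D : Carrier
    D = a + (b + b) * H

  euler-relation : ∀ a b Q θQ H θH t → a * H + b * (H * H) ≈ t →
    a * θH + b * (θH * H + H * θH) ≈ t →
    Q * (a + (b + b) * H) ≈ t * H →
    θQ * (a + (b + b) * H) + Q * ((b + b) * θH) ≈ t * H + t * θH →
    (a * a + (b + b + b + b) * t) * θQ + (b + b) * (t * Q) ≈ t * t + (a * a + (b + b + b + b) * t) * Q
  euler-relation a b Q θQ H θH t aH+bH²≈t θ[aH+bH²]≈t QD≈tH θ[QD]≈θ[tH] = begin
    (a * a + b₄ * t) * θQ + (b + b) * (t * Q)   ≈⟨ +-cong (*-congʳ (sym D²≈)) (*-congˡ (*-congʳ (sym DθH≈t))) ⟩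
    D * D * θQ + (b + b) * (D * θH * Q)
      ≈⟨ solve 6 (λ a b Q θQ H θH →
           (a :+ (b :+ b) :* H) :* (a :+ (b :+ b) :* H) :* θQ :+ (b :+ b) :* ((a :+ (b :+ b) :* H) :* θH :* Q)
           := (a :+ (b :+ b) :* H) :* (θQ :* (a :+ (b :+ b) :* H) :+ Q :* ((b :+ b) :* θH))) refl a b Q θQ H θH ⟩
    D * (θQ * D + Q * ((b + b) * θH))           ≈⟨ *-congˡ (trans θ[QD]≈θ[tH] (+-congʳ (sym QD≈tH))) ⟩
    D * (Q * D + t * θH)
      ≈⟨ solve 6 (λ a b Q H θH t →
           (a :+ (b :+ b) :* H) :* (Q :* (a :+ (b :+ b) :* H) :+ t :* θH)
           := t :* ((a :+ (b :+ b) :* H) :* θH) :+ (a :+ (b :+ b) :* H) :* (a :+ (b :+ b) :* H) :* Q) refl a b Q H θH t ⟩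
    t * (D * θH) + D * D * Q                    ≈⟨ +-cong (*-congˡ DθH≈t) (*-congʳ D²≈) ⟩
    t * t + (a * a + b₄ * t) * Q                ∎
    where
    D b₄ : Carrier
    D  = a + (b + b) * H
    b₄ = b + b + b + b
    D²≈ : D * D ≈ a * a + b₄ * t
    D²≈ = trans (solve 3 (λ a b H → (a :+ (b :+ b) :* H) :* (a :+ (b :+ b) :* H)
                                  := a :* a :+ (b :+ b :+ b :+ b) :* (a :* H :+ b :* (H :* H))) refl a b H)
                (+-congˡ (*-congˡ aH+bH²≈t))
    DθH≈t : D * θH ≈ t
    DθH≈t = trans (solve 4 (λ a b H θH → (a :+ (b :+ b) :* H) :* θH := a :* θH :+ b :* (θH :* H :+ H :* θH)) refl a b H θH)
                  θ[aH+bH²]≈t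

module BivariateSeries {c ℓ} (R : CommutativeRing c ℓ) where
  open CommutativeRing R
  open RingOps R
  open FiniteSums R
  open PowerSeries R
  open RingOps powerSeriesRing using () renaming (pow to powˢ)

  _⁰ _¹ : Series2 → Series
  (f ⁰) n = f n 0
  (f ¹) n = f n 1

  ¹-*ₛ : ∀ f g → (f *ₛ g) ¹ ≋ f ⁰ *ˢ g ¹ +ˢ f ¹ *ˢ g ⁰
  ¹-*ₛ f g n = sumTo-+ n _ _

  tₛ⁰ : tₛ ⁰ ≋ tˢ
  tₛ⁰ 0             = refl
  tₛ⁰ 1             = refl
  tₛ⁰ (suc (suc n)) = refl

  tₛ¹ : tₛ ¹ ≋ 0ˢ
  tₛ¹ 0             = refl
  tₛ¹ 1             = refl
  tₛ¹ (suc (suc n)) = refl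

  constₛ⁰ : ∀ x → constₛ x ⁰ ≋ constˢ x
  constₛ⁰ x zero    = refl
  constₛ⁰ x (suc n) = refl

  constₛ¹ : ∀ x → constₛ x ¹ ≋ 0ˢ
  constₛ¹ x zero    = refl
  constₛ¹ x (suc n) = refl

  cₛ⁰ : cₛ ⁰ ≋ 0ˢ
  cₛ⁰ zero    = refl
  cₛ⁰ (suc n) = refl

  cₛ¹ : cₛ ¹ ≋ 1ˢ
  cₛ¹ zero    = refl
  cₛ¹ (suc n) = refl

  powₛ⁰ : ∀ g k → powₛ g k ⁰ ≋ powˢ (g ⁰) k
  powₛ⁰ g zero    = constₛ⁰ 1#
  powₛ⁰ g (suc k) = *ˢ-cong (λ _ → refl) (powₛ⁰ g k)

  powₛ¹ : ∀ g k → powₛ g (suc k) ¹ ≋ g ⁰ *ˢ powₛ g k ¹ +ˢ g ¹ *ˢ powˢ (g ⁰) k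
  powₛ¹ g k = 𝕊.trans (¹-*ₛ g (powₛ g k)) (𝕊.+-congˡ (*ˢ-cong {g = powₛ g k ⁰} 𝕊.refl (powₛ⁰ g k)))

  powₛ-vanish : ∀ g → NoConstTerm g → ∀ k n j → n < k → powₛ g k n j ≈ 0#
  powₛ-vanish g g₀≈0 (suc k) n j n<k =
    sumTo-zero n λ m m≤n → sumTo-zero j λ i _ → term m m≤n i
    where
    term : ∀ m → m ≤ n → ∀ i → g m i * powₛ g k (n ∸ m) (j ∸ i) ≈ 0#
    term zero    _   i = trans (*-congʳ (g₀≈0 i)) (zeroˡ _)
    term (suc m) m<n i = trans (*-congˡ (powₛ-vanish g g₀≈0 k (n ∸ suc m) (j ∸ i) n∸m<k)) (zeroʳ _)
      where
      n∸m<k : n ∸ suc m < k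
      n∸m<k = NP.<-≤-trans (NP.∸-monoʳ-< (s≤s z≤n) m<n) (N.s≤s⁻¹ n<k)

  composeₛ-polynomial : ∀ d j f g → (∀ k i → i ≤ j → d < k → f k i ≈ 0#) → NoConstTerm g → ∀ n →
    composeₛ f g n j ≈ sumTo d (λ k → sumTo j (λ i → f k i * powₛ g k n (j ∸ i)))
  composeₛ-polynomial d j f g f≈0 g₀≈0 n = sumTo-truncate d n
    (λ k d<k → sumTo-zero j (λ i i≤j → trans (*-congʳ (f≈0 k i i≤j d<k)) (zeroˡ _)))
    (λ k n<k → sumTo-zero j (λ i _ → trans (*-congˡ (powₛ-vanish g g₀≈0 k n (j ∸ i) n<k)) (zeroʳ _)))

  tₛ-*ₛ⁰ : ∀ f → (tₛ *ₛ f) ⁰ ≋ tˢ *ˢ f ⁰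
  tₛ-*ₛ⁰ f = *ˢ-cong {g = f ⁰} tₛ⁰ 𝕊.refl

  tₛ-*ₛ¹ : ∀ f → (tₛ *ₛ f) ¹ ≋ tˢ *ˢ f ¹
  tₛ-*ₛ¹ f = 𝕊.trans (¹-*ₛ tₛ f) (𝕊.trans (𝕊.+-cong (*ˢ-cong {g = f ¹} tₛ⁰ 𝕊.refl)
                                                     (𝕊.trans (*ˢ-cong {g = f ⁰} tₛ¹ 𝕊.refl) (𝕊.zeroˡ (f ⁰))))
                                          (𝕊.+-identityʳ _))

module CubicSeries {c ℓ} (R : CommutativeRing c ℓ) (a b : CommutativeRing.Carrier R) where
  open CommutativeRing R
  open RingOps R
  open PowerSeries R
  open BivariateSeries R
  open import Algebra.Solver.Ring.NaturalCoefficients.Default commutativeSemiring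
  module ≈-Reasoning = SetoidReasoning setoid

  p h : Series2
  p = (constₛ a +ₛ (constₛ b *ₛ tₛ)) +ₛ (cₛ *ₛ (tₛ *ₛ tₛ))
  h = tₛ *ₛ p

  p⁰ : p ⁰ ≋ constˢ a +ˢ constˢ b *ˢ tˢ
  p⁰ = 𝕊.trans (𝕊.+-cong (𝕊.+-cong (constₛ⁰ a) (*ˢ-cong {g = tₛ ⁰} (constₛ⁰ b) tₛ⁰))
                         (𝕊.trans (*ˢ-cong {g = (tₛ *ₛ tₛ) ⁰} cₛ⁰ 𝕊.refl) (𝕊.zeroˡ ((tₛ *ₛ tₛ) ⁰))))
               (𝕊.+-identityʳ _)

  p¹ : p ¹ ≋ tˢ *ˢ tˢ
  p¹ = begin
    constₛ a ¹ +ˢ (constₛ b *ₛ tₛ) ¹ +ˢ (cₛ *ₛ (tₛ *ₛ tₛ)) ¹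
      ≈⟨ 𝕊.+-cong (𝕊.+-cong (constₛ¹ a) (¹-*ₛ (constₛ b) tₛ)) (¹-*ₛ cₛ (tₛ *ₛ tₛ)) ⟩
    0ˢ +ˢ (constₛ b ⁰ *ˢ tₛ ¹ +ˢ constₛ b ¹ *ˢ tₛ ⁰)
       +ˢ (cₛ ⁰ *ˢ (tₛ *ₛ tₛ) ¹ +ˢ cₛ ¹ *ˢ (tₛ *ₛ tₛ) ⁰)
      ≈⟨ 𝕊.+-cong (𝕊.+-congˡ (𝕊.+-cong (*ˢ-cong {f = constₛ b ⁰} 𝕊.refl tₛ¹)
                                        (*ˢ-cong {g = tₛ ⁰} (constₛ¹ b) 𝕊.refl)))
                  (𝕊.+-cong (*ˢ-cong {g = (tₛ *ₛ tₛ) ¹} cₛ⁰ 𝕊.refl) (*ˢ-cong cₛ¹ (tₛ-*ₛ⁰ tₛ))) ⟩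
    0ˢ +ˢ (constₛ b ⁰ *ˢ 0ˢ +ˢ 0ˢ *ˢ tₛ ⁰) +ˢ (0ˢ *ˢ (tₛ *ₛ tₛ) ¹ +ˢ 1ˢ *ˢ (tˢ *ˢ tₛ ⁰))
      ≈⟨ 𝕊.+-cong (𝕊.trans (𝕊.+-identityˡ _)
                    (𝕊.trans (𝕊.+-cong (𝕊.zeroʳ (constₛ b ⁰)) (𝕊.zeroˡ (tₛ ⁰))) (𝕊.+-identityˡ 0ˢ)))
                  (𝕊.trans (𝕊.+-cong (𝕊.zeroˡ ((tₛ *ₛ tₛ) ¹)) (𝕊.*-identityˡ _)) (𝕊.+-identityˡ _)) ⟩
    0ˢ +ˢ tˢ *ˢ tₛ ⁰
      ≈⟨ 𝕊.trans (𝕊.+-identityˡ _) (*ˢ-cong {f = tˢ} 𝕊.refl tₛ⁰) ⟩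
    tˢ *ˢ tˢ ∎
    where open ≋-Reasoning

  h⁰-suc : ∀ k → h (suc k) 0 ≈ constˢ a k + b * tˢ k
  h⁰-suc k = trans (tₛ-*ₛ⁰ p (suc k)) (trans (tˢ-*ˢ-suc (p ⁰) k) (trans (p⁰ k) (+-congˡ (constˢ-*ˢ b tˢ k))))

  h¹-suc : ∀ k → h (suc k) 1 ≈ (tˢ *ˢ tˢ) k
  h¹-suc k = trans (tₛ-*ₛ¹ p (suc k)) (trans (tˢ-*ˢ-suc (p ¹) k) (p¹ k))

  h₀₀≈0 : h 0 0 ≈ 0#
  h₀₀≈0 = trans (tₛ-*ₛ⁰ p 0) (tˢ-*ˢ-zero (p ⁰))

  h₀₁≈0 : h 0 1 ≈ 0#
  h₀₁≈0 = trans (tₛ-*ₛ¹ p 0) (tˢ-*ˢ-zero (p ¹))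

  h₁₀≈a : h 1 0 ≈ a
  h₁₀≈a = trans (h⁰-suc 0) (trans (+-congˡ (zeroʳ b)) (+-identityʳ a))

  h₂₀≈b : h 2 0 ≈ b
  h₂₀≈b = trans (h⁰-suc 1) (trans (+-identityˡ _) (*-identityʳ b))

  h₃₊ₖ₀≈0 : ∀ k → h (3 N.+ k) 0 ≈ 0#
  h₃₊ₖ₀≈0 k = trans (h⁰-suc (2 N.+ k)) (trans (+-identityˡ _) (zeroʳ b))

  h₁₁≈0 : h 1 1 ≈ 0#
  h₁₁≈0 = trans (h¹-suc 0) (tˢ-*ˢ-zero tˢ)

  h₂₁≈0 : h 2 1 ≈ 0#
  h₂₁≈0 = trans (h¹-suc 1) (tˢ-*ˢ-suc tˢ 0)

  h₃₁≈1 : h 3 1 ≈ 1#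
  h₃₁≈1 = trans (h¹-suc 2) (tˢ-*ˢ-suc tˢ 1)

  h₄₊ₖ₁≈0 : ∀ k → h (4 N.+ k) 1 ≈ 0#
  h₄₊ₖ₁≈0 k = trans (h¹-suc (3 N.+ k)) (tˢ-*ˢ-suc tˢ (2 N.+ k))

  h-degree : ∀ k i → i ≤ 1 → 3 < k → h k i ≈ 0#
  h-degree (suc (suc (suc (suc k)))) 0 _ _ = h₃₊ₖ₀≈0 (suc k)
  h-degree (suc (suc (suc (suc k)))) 1 _ _ = h₄₊ₖ₁≈0 k
  h-degree (suc (suc (suc (suc k)))) (suc (suc i)) (s≤s ()) _
  h-degree 0             _ _ ()
  h-degree 1             _ _ (s≤s ())
  h-degree 2             _ _ (s≤s (s≤s ()))
  h-degree 3             _ _ (s≤s (s≤s (s≤s ())))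

  module _ (g : Series2) (g₀≈0 : NoConstTerm g) where
    private
      H G : Series
      H = g ⁰
      G = g ¹
      P : ℕ → Series2
      P = powₛ g

    powₛ-1⁰ : P 1 ⁰ ≋ H
    powₛ-1⁰ = 𝕊.trans (powₛ⁰ g 1) (𝕊.*-identityʳ H)

    powₛ-2⁰ : P 2 ⁰ ≋ H *ˢ H
    powₛ-2⁰ = 𝕊.trans (powₛ⁰ g 2) (𝕊.*-congˡ (𝕊.*-identityʳ H))

    powₛ-3⁰ : P 3 ⁰ ≋ H *ˢ H *ˢ H
    powₛ-3⁰ = 𝕊.trans (powₛ⁰ g 3)
                      (𝕊.trans (𝕊.*-congˡ (𝕊.*-congˡ (𝕊.*-identityʳ H))) (𝕊.sym (𝕊.*-assoc H H H)))

    powₛ-1¹ : P 1 ¹ ≋ G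
    powₛ-1¹ = 𝕊.trans (powₛ¹ g 0)
                      (𝕊.trans (𝕊.+-cong (𝕊.trans (*ˢ-cong {f = H} 𝕊.refl (constₛ¹ 1#)) (𝕊.zeroʳ H))
                                          (𝕊.*-identityʳ G))
                               (𝕊.+-identityˡ G))

    powₛ-2¹ : P 2 ¹ ≋ H *ˢ G +ˢ G *ˢ H
    powₛ-2¹ = 𝕊.trans (powₛ¹ g 1) (𝕊.+-cong (*ˢ-cong {f = H} 𝕊.refl powₛ-1¹) (𝕊.*-congˡ (𝕊.*-identityʳ H)))

    composeₛ-h⁰ : composeₛ h g ⁰ ≋ constˢ a *ˢ H +ˢ constˢ b *ˢ (H *ˢ H)
    composeₛ-h⁰ n = begin
      composeₛ h g n 0
        ≈⟨ composeₛ-polynomial 3 0 h g (λ k i i≤0 → h-degree k i (NP.≤-trans i≤0 z≤n)) g₀≈0 n ⟩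
      h 0 0 * P 0 n 0 + h 1 0 * P 1 n 0 + h 2 0 * P 2 n 0 + h 3 0 * P 3 n 0
        ≈⟨ +-cong (+-cong (+-cong (*-congʳ h₀₀≈0) (*-congʳ h₁₀≈a)) (*-congʳ h₂₀≈b))
                  (*-congʳ (h₃₊ₖ₀≈0 0)) ⟩
      0# * P 0 n 0 + a * P 1 n 0 + b * P 2 n 0 + 0# * P 3 n 0
        ≈⟨ solve 6 (λ a b x y z w → con 0 :* x :+ a :* y :+ b :* z :+ con 0 :* w := a :* y :+ b :* z) refl
                   a b (P 0 n 0) (P 1 n 0) (P 2 n 0) (P 3 n 0) ⟩
      a * P 1 n 0 + b * P 2 n 0
        ≈⟨ +-cong (*-congˡ (powₛ-1⁰ n)) (*-congˡ (powₛ-2⁰ n)) ⟩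
      a * H n + b * (H *ˢ H) n
        ≈⟨ sym (+-cong (constˢ-*ˢ a H n) (constˢ-*ˢ b (H *ˢ H) n)) ⟩
      (constˢ a *ˢ H +ˢ constˢ b *ˢ (H *ˢ H)) n ∎
      where open ≈-Reasoning

    composeₛ-h¹ : composeₛ h g ¹ ≋ constˢ a *ˢ G +ˢ constˢ b *ˢ (H *ˢ G +ˢ G *ˢ H) +ˢ H *ˢ H *ˢ H
    composeₛ-h¹ n = begin
      composeₛ h g n 1
        ≈⟨ composeₛ-polynomial 3 1 h g (λ k i → h-degree k i) g₀≈0 n ⟩
      (h 0 0 * P 0 n 1 + h 0 1 * P 0 n 0) + (h 1 0 * P 1 n 1 + h 1 1 * P 1 n 0)
        + (h 2 0 * P 2 n 1 + h 2 1 * P 2 n 0) + (h 3 0 * P 3 n 1 + h 3 1 * P 3 n 0)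
        ≈⟨ +-cong (+-cong (+-cong (+-cong (*-congʳ h₀₀≈0) (*-congʳ h₀₁≈0))
                                  (+-cong (*-congʳ h₁₀≈a) (*-congʳ h₁₁≈0)))
                          (+-cong (*-congʳ h₂₀≈b) (*-congʳ h₂₁≈0)))
                  (+-cong (*-congʳ (h₃₊ₖ₀≈0 0)) (*-congʳ h₃₁≈1)) ⟩
      (0# * P 0 n 1 + 0# * P 0 n 0) + (a * P 1 n 1 + 0# * P 1 n 0)
        + (b * P 2 n 1 + 0# * P 2 n 0) + (0# * P 3 n 1 + 1# * P 3 n 0)
        ≈⟨ solve 10 (λ a b x₀ y₀ x₁ y₁ x₂ y₂ x₃ y₃ →
             (con 0 :* x₀ :+ con 0 :* y₀) :+ (a :* x₁ :+ con 0 :* y₁)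
               :+ (b :* x₂ :+ con 0 :* y₂) :+ (con 0 :* x₃ :+ con 1 :* y₃)
             := a :* x₁ :+ b :* x₂ :+ y₃) refl
             a b (P 0 n 1) (P 0 n 0) (P 1 n 1) (P 1 n 0) (P 2 n 1) (P 2 n 0) (P 3 n 1) (P 3 n 0) ⟩
      a * P 1 n 1 + b * P 2 n 1 + P 3 n 0
        ≈⟨ +-cong (+-cong (*-congˡ (powₛ-1¹ n)) (*-congˡ (powₛ-2¹ n))) (powₛ-3⁰ n) ⟩
      a * G n + b * (H *ˢ G +ˢ G *ˢ H) n + (H *ˢ H *ˢ H) n
        ≈⟨ sym (+-congʳ (+-cong (constˢ-*ˢ a G n) (constˢ-*ˢ b (H *ˢ G +ˢ G *ˢ H) n))) ⟩
      (constˢ a *ˢ G +ˢ constˢ b *ˢ (H *ˢ G +ˢ G *ˢ H) +ˢ H *ˢ H *ˢ H) n ∎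
      where open ≈-Reasoning

module InverseSeriesCoefficients {c ℓ} (R : CommutativeRing c ℓ) (a b : CommutativeRing.Carrier R)
  (hbar : RingOps.Series2 R) (hbar₀≈0 : RingOps.NoConstTerm R hbar)
  (h∘hbar≈t : RingOps._≈ₛ_ R (RingOps.composeₛ R (CubicSeries.h R a b) hbar) (RingOps.tₛ R))
  (A : RingOps.Series2 R) (A*hbar≈t : RingOps._≈ₛ_ R (RingOps._*ₛ_ R A hbar) (RingOps.tₛ R)) where

  open CommutativeRing R
  open RingOps R
  open PowerSeries R
  open BivariateSeries R
  open CubicSeries R a b
  open InverseSeriesAlgebra 𝕊.commutativeSemiring
  open NatEmbedding R using (ι-homo-+; ι-homo-*)
  open import Algebra.Solver.Ring.NaturalCoefficients.Default commutativeSemiring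
  open import Algebra.Properties.Ring ring using (+-cancelʳ)

  α β H G Q D : Series
  α = constˢ a
  β = constˢ b
  H = hbar ⁰
  G = hbar ¹
  Q = A ¹
  D = α +ˢ (β +ˢ β) *ˢ H

  aH+bH²≈t : α *ˢ H +ˢ β *ˢ (H *ˢ H) ≋ tˢ
  aH+bH²≈t = 𝕊.trans (𝕊.sym (composeₛ-h⁰ hbar hbar₀≈0)) (λ n → trans (h∘hbar≈t n 0) (tₛ⁰ n))

  aG+b2HG+H³≈0 : α *ˢ G +ˢ β *ˢ (H *ˢ G +ˢ G *ˢ H) +ˢ H *ˢ H *ˢ H ≋ 0ˢ
  aG+b2HG+H³≈0 = 𝕊.trans (𝕊.sym (composeₛ-h¹ hbar hbar₀≈0)) (λ n → trans (h∘hbar≈t n 1) (tₛ¹ n))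

  A⁰H≈t : A ⁰ *ˢ H ≋ tˢ
  A⁰H≈t n = trans (A*hbar≈t n 0) (tₛ⁰ n)

  A⁰G+QH≈0 : A ⁰ *ˢ G +ˢ Q *ˢ H ≋ 0ˢ
  A⁰G+QH≈0 n = trans (sym (¹-*ₛ A hbar n)) (trans (A*hbar≈t n 1) (tₛ¹ n))

  QD≈tH : Q *ˢ D ≋ tˢ *ˢ H
  QD≈tH = tˢ-*ˢ-cancel (quotient-relation α β (A ⁰) Q G H tˢ A⁰H≈t A⁰G+QH≈0 aG+b2HG+H³≈0)

  θ[aH+bH²]≈t : α *ˢ θ H +ˢ β *ˢ (θ H *ˢ H +ˢ H *ˢ θ H) ≋ tˢ
  θ[aH+bH²]≈t = begin
    α *ˢ θ H +ˢ β *ˢ (θ H *ˢ H +ˢ H *ˢ θ H)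
      ≈⟨ 𝕊.sym (𝕊.+-cong (θ-*ˢ-constant α H (θ-constˢ a))
                         (𝕊.trans (θ-*ˢ-constant β (H *ˢ H) (θ-constˢ b)) (*ˢ-cong {f = β} 𝕊.refl (θ-*ˢ H H)))) ⟩
    θ (α *ˢ H) +ˢ θ (β *ˢ (H *ˢ H))   ≈⟨ 𝕊.sym (θ-+ˢ (α *ˢ H) (β *ˢ (H *ˢ H))) ⟩
    θ (α *ˢ H +ˢ β *ˢ (H *ˢ H))       ≈⟨ θ-cong aH+bH²≈t ⟩
    θ tˢ                              ≈⟨ θ-tˢ ⟩
    tˢ                                ∎
    where open ≋-Reasoning

  θ[QD]≈θ[tH] : θ Q *ˢ D +ˢ Q *ˢ ((β +ˢ β) *ˢ θ H) ≋ tˢ *ˢ H +ˢ tˢ *ˢ θ H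
  θ[QD]≈θ[tH] = begin
    θ Q *ˢ D +ˢ Q *ˢ ((β +ˢ β) *ˢ θ H)   ≈⟨ 𝕊.+-congˡ (*ˢ-cong {f = Q} 𝕊.refl (𝕊.sym θD≋)) ⟩
    θ Q *ˢ D +ˢ Q *ˢ θ D                 ≈⟨ 𝕊.sym (θ-*ˢ Q D) ⟩
    θ (Q *ˢ D)                           ≈⟨ θ-cong QD≈tH ⟩
    θ (tˢ *ˢ H)                          ≈⟨ θ-*ˢ tˢ H ⟩
    θ tˢ *ˢ H +ˢ tˢ *ˢ θ H               ≈⟨ 𝕊.+-congʳ (*ˢ-cong {g = H} θ-tˢ 𝕊.refl) ⟩
    tˢ *ˢ H +ˢ tˢ *ˢ θ H                 ∎
    where
    open ≋-Reasoning
    θ[β+β]≋0 : θ (β +ˢ β) ≋ 0ˢ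
    θ[β+β]≋0 = 𝕊.trans (θ-+ˢ β β) (𝕊.trans (𝕊.+-cong (θ-constˢ b) (θ-constˢ b)) (𝕊.+-identityˡ 0ˢ))
    θD≋ : θ D ≋ (β +ˢ β) *ˢ θ H
    θD≋ = 𝕊.trans (θ-+ˢ α ((β +ˢ β) *ˢ H))
                  (𝕊.trans (𝕊.+-cong (θ-constˢ a) (θ-*ˢ-constant (β +ˢ β) H θ[β+β]≋0)) (𝕊.+-identityˡ _))

  euler-equation : (α *ˢ α +ˢ (β +ˢ β +ˢ β +ˢ β) *ˢ tˢ) *ˢ θ Q +ˢ (β +ˢ β) *ˢ (tˢ *ˢ Q)
                   ≋ tˢ *ˢ tˢ +ˢ (α *ˢ α +ˢ (β +ˢ β +ˢ β +ˢ β) *ˢ tˢ) *ˢ Q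
  euler-equation = euler-relation α β Q (θ Q) H (θ H) tˢ aH+bH²≈t θ[aH+bH²]≈t QD≈tH θ[QD]≈θ[tH]

  private
    b₄ : Carrier
    b₄ = b + b + b + b

    β+β+β+β≋b₄ : β +ˢ β +ˢ β +ˢ β ≋ constˢ b₄
    β+β+β+β≋b₄ = 𝕊.trans (𝕊.+-congʳ (𝕊.trans (𝕊.+-congʳ (constˢ-+ˢ b b)) (constˢ-+ˢ (b + b) b)))
                         (constˢ-+ˢ (b + b + b) b)

    [β+β]-*ˢ : ∀ X m → ((β +ˢ β) *ˢ X) m ≈ (b + b) * X m
    [β+β]-*ˢ X m = trans (*ˢ-cong {g = X} (constˢ-+ˢ b b) 𝕊.refl m) (constˢ-*ˢ (b + b) X m)

    [a²+4bt]-*ˢ : ∀ X m → ((α *ˢ α +ˢ (β +ˢ β +ˢ β +ˢ β) *ˢ tˢ) *ˢ X) m ≈ a * (a * X m) + b₄ * (tˢ *ˢ X) m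
    [a²+4bt]-*ˢ X m = begin
      ((α *ˢ α +ˢ (β +ˢ β +ˢ β +ˢ β) *ˢ tˢ) *ˢ X) m
        ≈⟨ 𝕊.distribʳ X (α *ˢ α) ((β +ˢ β +ˢ β +ˢ β) *ˢ tˢ) m ⟩
      ((α *ˢ α) *ˢ X) m + (((β +ˢ β +ˢ β +ˢ β) *ˢ tˢ) *ˢ X) m
        ≈⟨ +-cong (𝕊.*-assoc α α X m) (𝕊.*-assoc (β +ˢ β +ˢ β +ˢ β) tˢ X m) ⟩
      (α *ˢ (α *ˢ X)) m + ((β +ˢ β +ˢ β +ˢ β) *ˢ (tˢ *ˢ X)) m
        ≈⟨ +-cong (trans (constˢ-*ˢ a (α *ˢ X) m) (*-congˡ (constˢ-*ˢ a X m)))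
                  (trans (*ˢ-cong {g = tˢ *ˢ X} β+β+β+β≋b₄ 𝕊.refl m) (constˢ-*ˢ b₄ (tˢ *ˢ X) m)) ⟩
      a * (a * X m) + b₄ * (tˢ *ˢ X) m ∎
      where open SetoidReasoning setoid

  Q-recurrence : ∀ n → a * a * ι (suc n) * Q (2 N.+ n) + b * ι (4 N.* n N.+ 2) * Q (suc n) ≈ tˢ (suc n)
  -- The coefficient of t^(n+2) in euler-equation, with the summand Y common to both sides.
  Q-recurrence n = +-cancelʳ Y _ _ (begin
    X + Y
      ≈⟨ +-congʳ (+-congˡ (*-congʳ (*-congˡ (trans (ι-homo-+ (4 N.* n) 2) (+-congʳ (ι-homo-* 4 n)))))) ⟩
    (a * a * ι (suc n) * Q (2 N.+ n) + b * (ι 4 * ι n + ι 2) * Q (suc n)) + Y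
      ≈⟨ solve 5 (λ a b v q₂ q₁ →
           (a :* a :* (con 1 :+ v) :* q₂
              :+ b :* ((con 1 :+ (con 1 :+ (con 1 :+ (con 1 :+ con 0)))) :* v :+ (con 1 :+ (con 1 :+ con 0))) :* q₁)
             :+ (a :* (a :* q₂) :+ (b :+ b :+ b :+ b) :* q₁)
           := a :* (a :* ((con 1 :+ (con 1 :+ v)) :* q₂)) :+ (b :+ b :+ b :+ b) :* ((con 1 :+ v) :* q₁) :+ (b :+ b) :* q₁)
           refl a b (ι n) (Q (2 N.+ n)) (Q (suc n)) ⟩
    a * (a * θ Q (2 N.+ n)) + b₄ * θ Q (suc n) + (b + b) * Q (suc n)
      ≈⟨ sym (+-cong (+-congˡ (*-congˡ (tˢ-*ˢ-suc (θ Q) (suc n)))) (*-congˡ (tˢ-*ˢ-suc Q (suc n)))) ⟩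
    a * (a * θ Q (2 N.+ n)) + b₄ * (tˢ *ˢ θ Q) (2 N.+ n) + (b + b) * (tˢ *ˢ Q) (2 N.+ n)
      ≈⟨ sym (+-cong ([a²+4bt]-*ˢ (θ Q) (2 N.+ n)) ([β+β]-*ˢ (tˢ *ˢ Q) (2 N.+ n))) ⟩
    ((α *ˢ α +ˢ (β +ˢ β +ˢ β +ˢ β) *ˢ tˢ) *ˢ θ Q +ˢ (β +ˢ β) *ˢ (tˢ *ˢ Q)) (2 N.+ n)
      ≈⟨ euler-equation (2 N.+ n) ⟩
    (tˢ *ˢ tˢ +ˢ (α *ˢ α +ˢ (β +ˢ β +ˢ β +ˢ β) *ˢ tˢ) *ˢ Q) (2 N.+ n)
      ≈⟨ +-cong (tˢ-*ˢ-suc tˢ (suc n)) (trans ([a²+4bt]-*ˢ Q (2 N.+ n)) (+-congˡ (*-congˡ (tˢ-*ˢ-suc Q (suc n))))) ⟩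
    tˢ (suc n) + Y ∎)
    where
    open SetoidReasoning setoid
    X Y : Carrier
    X = a * a * ι (suc n) * Q (2 N.+ n) + b * ι (4 N.* n N.+ 2) * Q (suc n)
    Y = a * (a * Q (2 N.+ n)) + b₄ * Q (suc n)

  D₀≈a : D 0 ≈ a
  D₀≈a = trans (+-congˡ (trans (*-congˡ (hbar₀≈0 0)) (zeroʳ _))) (+-identityʳ a)

  Q₀D₀≈0 : Q 0 * D 0 ≈ 0#
  Q₀D₀≈0 = trans (QD≈tH 0) (tˢ-*ˢ-zero H)

  Q₀D₁+Q₁D₀≈0 : Q 0 * D 1 + Q 1 * D 0 ≈ 0#
  Q₀D₁+Q₁D₀≈0 = trans (QD≈tH 1) (trans (tˢ-*ˢ-suc H 0) (hbar₀≈0 0))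

module Binomial where
  open import Data.Nat
  open import Data.Nat.Properties
  open import Data.Nat.Combinatorics using (_C_; k>n⇒nCk≡0; nC1≡n; nCk≡nC[n∸k]; nCk+nC[k+1]≡[n+1]C[k+1])
  open import Relation.Binary.PropositionalEquality
  open import Data.Nat.Solver using (module +-*-Solver)
  open +-*-Solver

  C-absorption : ∀ n k → suc k * (suc n C suc k) ≡ suc n * (n C k)
  C-absorption zero    zero    = refl
  C-absorption zero    (suc k) rewrite k>n⇒nCk≡0 {1} {2 + k} (s≤s (s≤s z≤n)) | k>n⇒nCk≡0 {0} {suc k} (s≤s z≤n) =
    *-zeroʳ (2 + k)
  C-absorption (suc n) zero    rewrite nC1≡n (2 + n) = *-comm 1 (2 + n)
  C-absorption (suc n) (suc k) = begin
    (2 + k) * ((2 + n) C (2 + k))                 ≡⟨ cong ((2 + k) *_) (sym (nCk+nC[k+1]≡[n+1]C[k+1] (suc n) (suc k))) ⟩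
    (2 + k) * (x + y)
      ≡⟨ solve 3 (λ k x y → (con 2 :+ k) :* (x :+ y) := (con 1 :+ k) :* x :+ x :+ (con 2 :+ k) :* y) refl k x y ⟩
    (1 + k) * x + x + (2 + k) * y                 ≡⟨ cong₂ (λ u w → u + x + w) (C-absorption n k) (C-absorption n (suc k)) ⟩
    (1 + n) * (n C k) + x + (1 + n) * (n C suc k)
      ≡⟨ solve 4 (λ n p q x → (con 1 :+ n) :* p :+ x :+ (con 1 :+ n) :* q := (con 1 :+ n) :* (p :+ q) :+ x)
                 refl n (n C k) (n C suc k) x ⟩
    (1 + n) * (n C k + n C suc k) + x             ≡⟨ cong (λ z → (1 + n) * z + x) (nCk+nC[k+1]≡[n+1]C[k+1] n k) ⟩
    (1 + n) * x + x                               ≡⟨ solve 2 (λ n x → (con 1 :+ n) :* x :+ x := (con 2 :+ n) :* x) refl n x ⟩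
    (2 + n) * x                                   ∎
    where
    open ≡-Reasoning
    x y : ℕ
    x = suc n C suc k
    y = suc n C suc (suc k)

  binomial-recurrence : ∀ n → (2 + n) * ((2 * suc n + 1) C (suc n + 1)) ≡ (4 * suc n + 2) * ((2 * n + 1) C (n + 1))
  binomial-recurrence n = begin
    (2 + n) * ((2 * suc n + 1) C (suc n + 1))   ≡⟨ cong₂ (λ k l → (2 + n) * (l C suc k)) (+-comm n 1) 2n+3≡ ⟩
    suc (suc n) * (suc (suc m) C suc (suc n))   ≡⟨ C-absorption (suc m) (suc n) ⟩
    suc (suc m) * (suc m C suc n)               ≡⟨ cong (suc (suc m) *_) (sym (nCk+nC[k+1]≡[n+1]C[k+1] m n)) ⟩
    suc (suc m) * (m C n + m C suc n)           ≡⟨ cong (λ z → suc (suc m) * (z + m C suc n)) symmetry ⟩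
    suc (suc m) * (m C suc n + m C suc n)
      ≡⟨ solve 2 (λ n c → (con 2 :+ (con 2 :* n :+ con 1)) :* (c :+ c) := (con 4 :* (con 1 :+ n) :+ con 2) :* c)
                 refl n (m C suc n) ⟩
    (4 * suc n + 2) * (m C suc n)                   ≡⟨ cong (λ k → (4 * suc n + 2) * (m C k)) (+-comm 1 n) ⟩
    (4 * suc n + 2) * (m C (n + 1))                 ∎
    where
    open ≡-Reasoning
    m : ℕ
    m = 2 * n + 1
    2n+3≡ : 2 * suc n + 1 ≡ suc (suc m)
    2n+3≡ = solve 1 (λ n → con 2 :* (con 1 :+ n) :+ con 1 := con 2 :+ (con 2 :* n :+ con 1)) refl n
    m∸n≡1+n : m ∸ n ≡ suc n
    m∸n≡1+n = trans (cong (_∸ n) (solve 1 (λ n → con 2 :* n :+ con 1 := n :+ (con 1 :+ n)) refl n)) (m+n∸m≡n n (suc n))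
    symmetry : m C n ≡ m C suc n
    symmetry = trans (nCk≡nC[n∸k] (≤-trans (m≤m+n n (n + 0)) (m≤m+n (2 * n) 1))) (cong (m C_) m∸n≡1+n)

module FieldProperties {c ℓ} (K : Field c ℓ) where
  open Field K
  open RingProperties ring using (+-inverseˡ-unique)
  open SetoidReasoning setoid

  *-cancelˡ : ∀ {x y z} → ¬ (x ≈ 0#) → x * y ≈ x * z → y ≈ z
  *-cancelˡ {x} {y} {z} x≉0 xy≈xz = begin
    y                   ≈⟨ sym (*-identityˡ y) ⟩
    1# * y              ≈⟨ *-congʳ (sym x⁻¹x≈1) ⟩
    inv x x≉0 * x * y   ≈⟨ *-assoc _ _ _ ⟩
    inv x x≉0 * (x * y) ≈⟨ *-congˡ xy≈xz ⟩
    inv x x≉0 * (x * z) ≈⟨ sym (*-assoc _ _ _) ⟩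
    inv x x≉0 * x * z   ≈⟨ *-congʳ x⁻¹x≈1 ⟩
    1# * z              ≈⟨ *-identityˡ z ⟩
    z                   ∎
    where
    x⁻¹x≈1 : inv x x≉0 * x ≈ 1#
    x⁻¹x≈1 = trans (*-comm _ _) (inverseʳ x x≉0)

  *-≉0 : ∀ {x y} → ¬ (x ≈ 0#) → ¬ (y ≈ 0#) → ¬ (x * y ≈ 0#)
  *-≉0 {x} x≉0 y≉0 xy≈0 = y≉0 (*-cancelˡ x≉0 (trans xy≈0 (sym (zeroʳ x))))

  *≈0⇒≈0 : ∀ {x y} → ¬ (y ≈ 0#) → x * y ≈ 0# → x ≈ 0#
  *≈0⇒≈0 {x} {y} y≉0 xy≈0 = *-cancelˡ y≉0 (trans (*-comm y x) (trans xy≈0 (sym (zeroʳ y))))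

  recurrence-unique : ∀ (u v x y : ℕ → Carrier) → (∀ n → ¬ (u n ≈ 0#)) →
    (∀ n → u n * x (suc n) + v n * x n ≈ 0#) → (∀ n → u n * y (suc n) + v n * y n ≈ 0#) →
    x 0 ≈ y 0 → ∀ n → x n ≈ y n
  recurrence-unique u v x y u≉0 x-rec y-rec x₀≈y₀ zero    = x₀≈y₀
  recurrence-unique u v x y u≉0 x-rec y-rec x₀≈y₀ (suc n) = *-cancelˡ (u≉0 n) (begin
    u n * x (suc n) ≈⟨ +-inverseˡ-unique _ _ (x-rec n) ⟩
    - (v n * x n)   ≈⟨ -‿cong (*-congˡ (recurrence-unique u v x y u≉0 x-rec y-rec x₀≈y₀ n)) ⟩
    - (v n * y n)   ≈⟨ sym (+-inverseˡ-unique _ _ (y-rec n)) ⟩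
    u n * y (suc n) ∎)

module ClosedForm {c ℓ} (K : Field c ℓ) (a b : Field.Carrier K) (a≉0 : ¬ (Field._≈_ K a (Field.0# K))) where
  open Field K
  open RingOps commutativeRing
  open NatEmbedding commutativeRing using (ι-homo-*)
  open import Algebra.Solver.Ring.NaturalCoefficients.Default commutativeSemiring
  open Binomial using (binomial-recurrence)
  open SetoidReasoning setoid

  a⁻¹ : Carrier
  a⁻¹ = inv a a≉0

  closedForm : ℕ → Carrier
  closedForm n = (pow (- b) n * pow a⁻¹ (2 N.* n N.+ 2)) * ι ((2 N.* n N.+ 1) C (n N.+ 1))

  closedForm-initial : a * a * closedForm 0 ≈ 1#
  closedForm-initial = begin
    a * a * closedForm 0
      ≈⟨ solve 2 (λ a a⁻¹ → a :* a :* ((con 1 :* (a⁻¹ :* (a⁻¹ :* con 1))) :* (con 1 :+ con 0))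
                            := (a :* a⁻¹) :* (a :* a⁻¹)) refl a a⁻¹ ⟩
    (a * a⁻¹) * (a * a⁻¹)   ≈⟨ *-cong (inverseʳ a a≉0) (inverseʳ a a≉0) ⟩
    1# * 1#                 ≈⟨ *-identityˡ 1# ⟩
    1#                      ∎

  closedForm-recurrence : ∀ n → a * a * ι (2 N.+ n) * closedForm (suc n) + b * ι (4 N.* suc n N.+ 2) * closedForm n ≈ 0#
  closedForm-recurrence n = begin
    a * a * ι (2 N.+ n) * closedForm (suc n) + b * ι (4 N.* suc n N.+ 2) * closedForm n
      ≈⟨ +-congʳ leading-term ⟩
    - b * ι (4 N.* suc n N.+ 2) * closedForm n + b * ι (4 N.* suc n N.+ 2) * closedForm n
      ≈⟨ trans (sym (distribʳ _ _ _)) (*-congʳ (sym (distribʳ _ _ _))) ⟩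
    (- b + b) * ι (4 N.* suc n N.+ 2) * closedForm n
      ≈⟨ *-congʳ (*-congʳ (-‿inverseˡ b)) ⟩
    0# * ι (4 N.* suc n N.+ 2) * closedForm n
      ≈⟨ trans (*-congʳ (zeroˡ _)) (zeroˡ _) ⟩
    0# ∎
    where
    Pₙ Wₙ Bₙ Bₙ₊₁ : Carrier
    Pₙ   = pow (- b) n
    Wₙ   = pow a⁻¹ (2 N.* n N.+ 2)
    Bₙ   = ι ((2 N.* n N.+ 1) C (n N.+ 1))
    Bₙ₊₁ = ι ((2 N.* suc n N.+ 1) C (suc n N.+ 1))
    binomial : ι (2 N.+ n) * Bₙ₊₁ ≈ ι (4 N.* suc n N.+ 2) * Bₙ
    binomial = trans (sym (ι-homo-* (2 N.+ n) ((2 N.* suc n N.+ 1) C (suc n N.+ 1))))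
                     (trans (reflexive (P.cong ι (binomial-recurrence n))) (ι-homo-* (4 N.* suc n N.+ 2) ((2 N.* n N.+ 1) C (n N.+ 1))))
    leading-term : a * a * ι (2 N.+ n) * closedForm (suc n) ≈ - b * ι (4 N.* suc n N.+ 2) * closedForm n
    leading-term = begin
      a * a * ι (2 N.+ n) * ((- b * Pₙ * pow a⁻¹ (2 N.* suc n N.+ 2)) * Bₙ₊₁)
        ≈⟨ *-congˡ (*-congʳ (*-congˡ (reflexive (P.cong (pow a⁻¹) (P.cong (N._+ 2) (NP.*-suc 2 n)))))) ⟩
      a * a * ι (2 N.+ n) * ((- b * Pₙ * (a⁻¹ * (a⁻¹ * Wₙ))) * Bₙ₊₁)
        ≈⟨ solve 7 (λ a a⁻¹ nb P W ι₂ B → a :* a :* ι₂ :* ((nb :* P :* (a⁻¹ :* (a⁻¹ :* W))) :* B)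
                                         := (a :* a⁻¹) :* (a :* a⁻¹) :* nb :* (P :* W) :* (ι₂ :* B))
                   refl a a⁻¹ (- b) Pₙ Wₙ (ι (2 N.+ n)) Bₙ₊₁ ⟩
      (a * a⁻¹) * (a * a⁻¹) * - b * (Pₙ * Wₙ) * (ι (2 N.+ n) * Bₙ₊₁)
        ≈⟨ *-cong (*-congʳ (*-congʳ (*-cong (inverseʳ a a≉0) (inverseʳ a a≉0)))) binomial ⟩
      1# * 1# * - b * (Pₙ * Wₙ) * (ι (4 N.* suc n N.+ 2) * Bₙ)
        ≈⟨ solve 5 (λ nb P W ι₆ B → con 1 :* con 1 :* nb :* (P :* W) :* (ι₆ :* B) := nb :* ι₆ :* (P :* W :* B))
                   refl (- b) Pₙ Wₙ (ι (4 N.* suc n N.+ 2)) Bₙ ⟩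
      - b * ι (4 N.* suc n N.+ 2) * closedForm n ∎

module InverseSeriesOverField {c ℓ} (K : Field c ℓ) where
  open Field K
  open RingOps commutativeRing
  open FieldProperties K
  open import Algebra.Solver.Ring.NaturalCoefficients.Default commutativeSemiring
  open SetoidReasoning setoid

  module _ (charZero : CharZero) (a b : Carrier) (a≉0 : ¬ (a ≈ 0#)) (hbar : Series2) (hbar₀≈0 : NoConstTerm hbar)
           (h∘hbar≈t : composeₛ (CubicSeries.h commutativeRing a b) hbar ≈ₛ tₛ)
           (A : Series2) (A*hbar≈t : (A *ₛ hbar) ≈ₛ tₛ) where
    open ClosedForm K a b a≉0
    open InverseSeriesCoefficients commutativeRing a b hbar hbar₀≈0 h∘hbar≈t A A*hbar≈t

    D₀≉0 : ¬ (D 0 ≈ 0#)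
    D₀≉0 D₀≈0 = a≉0 (trans (sym D₀≈a) D₀≈0)

    Q₀≈0 : Q 0 ≈ 0#
    Q₀≈0 = *≈0⇒≈0 D₀≉0 Q₀D₀≈0

    Q₁≈0 : Q 1 ≈ 0#
    Q₁≈0 = *≈0⇒≈0 D₀≉0 (begin
      Q 1 * D 0               ≈⟨ sym (+-identityˡ _) ⟩
      0# + Q 1 * D 0          ≈⟨ +-congʳ (sym (trans (*-congʳ Q₀≈0) (zeroˡ _))) ⟩
      Q 0 * D 1 + Q 1 * D 0   ≈⟨ Q₀D₁+Q₁D₀≈0 ⟩
      0#                      ∎)

    a²Q₂≈1 : a * a * Q 2 ≈ 1#
    a²Q₂≈1 = begin
      a * a * Q 2
        ≈⟨ solve 3 (λ a b x → a :* a :* x := a :* a :* (con 1 :+ con 0) :* x :+ b :* (con 1 :+ (con 1 :+ con 0)) :* con 0)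
                   refl a b (Q 2) ⟩
      a * a * ι 1 * Q 2 + b * ι 2 * 0#    ≈⟨ +-congˡ (*-congˡ (sym Q₁≈0)) ⟩
      a * a * ι 1 * Q 2 + b * ι 2 * Q 1   ≈⟨ Q-recurrence 0 ⟩
      1#                                  ∎

    Q-closedForm : ∀ n → Q (2 N.+ n) ≈ closedForm n
    Q-closedForm = recurrence-unique
      (λ n → a * a * ι (2 N.+ n)) (λ n → b * ι (4 N.* suc n N.+ 2)) (λ n → Q (2 N.+ n)) closedForm
      (λ n → *-≉0 (*-≉0 a≉0 a≉0) (charZero (suc n)))
      (λ n → Q-recurrence (suc n)) closedForm-recurrence
      (*-cancelˡ (*-≉0 a≉0 a≉0) (trans a²Q₂≈1 (sym closedForm-initial)))

theorem6 : ∀ {c ℓ} (K : Field c ℓ) →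
    let open Field K in
    let open RingOps commutativeRing in
    CharZero →
    (a b : Carrier) (a≉0 : ¬ (a ≈ 0#)) →
    -- h(t) = t p(t),  p(t) = a + b t + c t^2
    let h = tₛ *ₛ ((constₛ a +ₛ (constₛ b *ₛ tₛ)) +ₛ (cₛ *ₛ (tₛ *ₛ tₛ))) in
    -- hbar is the compositional inverse of h
    (hbar : Series2) → NoConstTerm hbar →
    composeₛ h hbar ≈ₛ tₛ → composeₛ hbar h ≈ₛ tₛ →
    -- A(t) = t / hbar(t)
    (A : Series2) → (A *ₛ hbar) ≈ₛ tₛ →
    -- [t^(n+2)] dA/dc |_(c=0)  is the coefficient of t^(n+2) c^1
    (n : ℕ) →
    A (n N.+ 2) 1 ≈ (pow (- b) n * pow (inv a a≉0) (2 N.* n N.+ 2)) * ι ((2 N.* n N.+ 1) C (n N.+ 1))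
theorem6 K charZero a b a≉0 hbar hbar₀≈0 h∘hbar≈t _ A A*hbar≈t n =
  P.subst (λ m → A m 1 ≈ closedForm n) (NP.+-comm 2 n)
    (Q-closedForm charZero a b a≉0 hbar hbar₀≈0 h∘hbar≈t A A*hbar≈t n)
  where
  open Field K
  open ClosedForm K a b a≉0 using (closedForm)
  open InverseSeriesOverField K using (Q-closedForm)
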